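{- Let $\Delta$ be a strongly shellable simplicial complex. Then $\operatorname{link}_\Delta(A)$ is strongly shellable for every face $A\in\Delta$.
   Context: A simplicial complex is a finite family of subsets of a vertex set closed under taking subsets; $\mathcal{F}(\Delta)$ is its set of facets. A linear order $F_1,\dots,F_t$ of $\mathcal{F}(\Delta)$ is a strong shelling order if for every $1\le i<j\le t$ there exists $k$ with $1\le k<j$ such that $|F_j\setminus F_k|=1$, $F_j\setminus F_k\subseteq F_j\setminus F_i$, and $F_k\setminus F_j\subseteq F_i$; $\Delta$ is strongly shellable if such an order exists. The link of a face $A$ is $\operatorname{link}_\Delta(A)=\{B\in\Delta\mid B\cup A\in\Delta,\ B\cap A=\varnothing\}$. -}

module Defs where

open import Data.Nat using (ℕ)
open import Data.Fin using (Fin; _<_)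
open import Data.Fin.Subset using (Subset; _⊆_; _⊂_; _∪_; _∩_; _─_; ∣_∣; ⊥)
open import Data.List using (List; length; lookup)
open import Data.List.Relation.Unary.Unique.Propositional using (Unique)
open import Data.List.Membership.Propositional using () renaming (_∈_ to _∈ₗ_)
open import Data.Product using (Σ; _×_; ∃-syntax)
open import Relation.Binary.PropositionalEquality using (_≡_)
open import Relation.Nullary using (¬_)
open import Function.Bundles using (_⇔_)

-- A simplicial complex on the finite vertex set Fin n is given by its
-- family of faces (a predicate on subsets of Fin n), closed under subsets.
-- (Finiteness is automatic since Subset n is finite.)
Complex : ℕ → Set₁
Complex n = Subset n → Set

IsSimplicialComplex : ∀ {n} → Complex n → Set
IsSimplicialComplex {n} Δ = ∀ (A B : Subset n) → B ⊆ A → Δ A → Δ B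

IsFacet : ∀ {n} → Complex n → Subset n → Set
IsFacet {n} Δ F = Δ F × (∀ (G : Subset n) → Δ G → ¬ (F ⊂ G))

IsFacetOrder : ∀ {n} → Complex n → List (Subset n) → Set
IsFacetOrder {n} Δ L = Unique L × (∀ (F : Subset n) → (F ∈ₗ L) ⇔ IsFacet Δ F)

IsStrongShellingList : ∀ {n} → List (Subset n) → Set
IsStrongShellingList L =
  ∀ (i j : Fin (length L)) → i < j →
    ∃[ k ] (k < j
           × ∣ lookup L j ─ lookup L k ∣ ≡ 1
           × (lookup L j ─ lookup L k) ⊆ (lookup L j ─ lookup L i)
           × (lookup L k ─ lookup L j) ⊆ lookup L i)

IsStrongShellingOrder : ∀ {n} → Complex n → List (Subset n) → Set
IsStrongShellingOrder Δ L = IsFacetOrder Δ L × IsStrongShellingList L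

StronglyShellable : ∀ {n} → Complex n → Set
StronglyShellable {n} Δ = Σ (List (Subset n)) (IsStrongShellingOrder Δ)

link : ∀ {n} → Complex n → Subset n → Complex n
link Δ A B = Δ (B ∪ A) × (B ∩ A ≡ ⊥)

-- A facet of link_Δ(A) is G ∖ A for a facet G ⊇ A of Δ, and conversely, so a
-- shelling order of Δ restricts to an order of the link by keeping the facets
-- containing A and deleting A from them. In the strong shelling condition for
-- F_i, F_j ⊇ A the witness F_k also contains A: a vertex of A outside F_k would
-- lie in F_j ∖ F_k ⊆ F_j ∖ F_i, hence outside F_i. Then
-- (F_j ∖ A) ∖ (F_k ∖ A) = F_j ∖ F_k and (F_k ∖ A) ∖ (F_j ∖ A) = (F_k ∖ F_j) ∖ A,
-- so F_k ∖ A is a witness for the link.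
module Submission where

open import Defs
open import Data.Nat using (ℕ; s≤s; z≤n)
open import Data.Fin using (Fin; zero; suc; _<_)
open import Data.Fin.Properties using (<-cmp; <-irrefl; <-asym)
open import Data.Fin.Subset using (Subset; _⊆_; _∪_; _∩_; _─_; ∣_∣; ⊥; _∈_; _∉_; inside; outside)
open import Data.Fin.Subset.Properties using (_⊆?_; _∈?_; ⊆-antisym; ∉⊥; p─q⊆p; x∈p∧x∉q⇒x∈p─q; x∈p∩q⁺; x∈p∪q⁻; p⊆p∪q; q⊆p∪q)
open import Data.List using (List; []; _∷_; length; lookup)
open import Data.List.Relation.Unary.Any using (index)
open import Data.List.Relation.Unary.Any.Properties using (lookup-index)
open import Data.List.Relation.Unary.All as All using ()
open import Data.List.Relation.Unary.AllPairs using ([]; _∷_)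
open import Data.List.Relation.Unary.Unique.Propositional using (Unique)
open import Data.List.Membership.Propositional using () renaming (_∈_ to _∈ₗ_)
open import Data.List.Membership.Propositional.Properties using (∈-lookup)
open import Data.Vec using (_∷_; []; there)
open import Data.Product using (_×_; _,_; ∃-syntax)
open import Data.Sum using ([_,_])
open import Data.Empty using (⊥-elim)
open import Relation.Binary.PropositionalEquality using (_≡_; refl; sym; trans; cong; subst; module ≡-Reasoning)
open import Relation.Binary.Definitions using (tri<; tri≈; tri>)
open import Relation.Nullary using (¬_; Dec; yes; no)
open import Function.Bundles using (mk⇔; Equivalence)

private variable n : ℕ

x∈p─q⇒x∉q : ∀ {p q : Subset n} {x} → x ∈ p ─ q → x ∉ q
x∈p─q⇒x∉q {p = _ ∷ _} {inside  ∷ _} (there x∈p─q) (there x∈q) = x∈p─q⇒x∉q x∈p─q x∈q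
x∈p─q⇒x∉q {p = _ ∷ _} {outside ∷ _} (there x∈p─q) (there x∈q) = x∈p─q⇒x∉q x∈p─q x∈q

p∩q≡⊥⇒x∈p⇒x∉q : ∀ {p q : Subset n} {x} → p ∩ q ≡ ⊥ → x ∈ p → x ∉ q
p∩q≡⊥⇒x∈p⇒x∉q p∩q≡⊥ x∈p x∈q = ∉⊥ (subst (_ ∈_) p∩q≡⊥ (x∈p∩q⁺ (x∈p , x∈q)))

p─q∩q≡⊥ : ∀ (p q : Subset n) → (p ─ q) ∩ q ≡ ⊥
p─q∩q≡⊥ []            []            = refl
p─q∩q≡⊥ (_       ∷ p) (inside  ∷ q) = cong (outside ∷_) (p─q∩q≡⊥ p q)
p─q∩q≡⊥ (inside  ∷ p) (outside ∷ q) = cong (outside ∷_) (p─q∩q≡⊥ p q)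
p─q∩q≡⊥ (outside ∷ p) (outside ∷ q) = cong (outside ∷_) (p─q∩q≡⊥ p q)

p─q∪q≡p : ∀ (p q : Subset n) → q ⊆ p → (p ─ q) ∪ q ≡ p
p─q∪q≡p p q q⊆p = ⊆-antisym
  (λ x∈ → [ p─q⊆p p q , q⊆p ] (x∈p∪q⁻ (p ─ q) q x∈))
  λ {x} x∈p → split (x ∈? q) x∈p
  where
  split : ∀ {x} → Dec (x ∈ q) → x ∈ p → x ∈ (p ─ q) ∪ q
  split (yes x∈q) _   = q⊆p∪q (p ─ q) q x∈q
  split (no  x∉q) x∈p = p⊆p∪q q (x∈p∧x∉q⇒x∈p─q x∈p x∉q)

p∪q─q≡p : ∀ (p q : Subset n) → p ∩ q ≡ ⊥ → (p ∪ q) ─ q ≡ p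
p∪q─q≡p p q p∩q≡⊥ = ⊆-antisym
  (λ x∈ → [ (λ x∈p → x∈p) , (λ x∈q → ⊥-elim (x∈p─q⇒x∉q x∈ x∈q)) ]
            (x∈p∪q⁻ p q (p─q⊆p (p ∪ q) q x∈)))
  (λ x∈p → x∈p∧x∉q⇒x∈p─q (p⊆p∪q q x∈p) (p∩q≡⊥⇒x∈p⇒x∉q p∩q≡⊥ x∈p))

─-cancelʳ : ∀ {p q r : Subset n} → r ⊆ p → r ⊆ q → p ─ r ≡ q ─ r → p ≡ q
─-cancelʳ {p = p} {q} {r} r⊆p r⊆q p─r≡q─r = begin
  p            ≡⟨ sym (p─q∪q≡p p r r⊆p) ⟩
  (p ─ r) ∪ r  ≡⟨ cong (_∪ r) p─r≡q─r ⟩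
  (q ─ r) ∪ r  ≡⟨ p─q∪q≡p q r r⊆q ⟩
  q            ∎
  where open ≡-Reasoning

─-monoˡ-⊆ : ∀ {p q : Subset n} (r : Subset n) → p ⊆ q → p ─ r ⊆ q ─ r
─-monoˡ-⊆ {p = p} r p⊆q x∈ = x∈p∧x∉q⇒x∈p─q (p⊆q (p─q⊆p p r x∈)) (x∈p─q⇒x∉q x∈)

p─r─[q─r]≡p─q─r : ∀ (p q r : Subset n) → (p ─ r) ─ (q ─ r) ≡ p ─ q ─ r
p─r─[q─r]≡p─q─r []      []            []            = refl
p─r─[q─r]≡p─q─r (_ ∷ p) (_       ∷ q) (inside  ∷ r) = cong (outside ∷_) (p─r─[q─r]≡p─q─r p q r)
p─r─[q─r]≡p─q─r (_ ∷ p) (inside  ∷ q) (outside ∷ r) = cong (outside ∷_) (p─r─[q─r]≡p─q─r p q r)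
p─r─[q─r]≡p─q─r (x ∷ p) (outside ∷ q) (outside ∷ r) = cong (x ∷_) (p─r─[q─r]≡p─q─r p q r)

p─q─r≡p─q : ∀ (p q r : Subset n) → r ⊆ q → p ─ q ─ r ≡ p ─ q
p─q─r≡p─q p q r r⊆q = ⊆-antisym (p─q⊆p (p ─ q) r)
  (λ x∈ → x∈p∧x∉q⇒x∈p─q x∈ (λ x∈r → x∈p─q⇒x∉q x∈ (r⊆q x∈r)))

p─r─[q─r]≡p─q : ∀ (p q r : Subset n) → r ⊆ q → (p ─ r) ─ (q ─ r) ≡ p ─ q
p─r─[q─r]≡p─q p q r r⊆q = trans (p─r─[q─r]≡p─q─r p q r) (p─q─r≡p─q p q r r⊆q)

IsStrongShellingWitness : (Fᵢ Fⱼ Fₖ : Subset n) → Set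
IsStrongShellingWitness Fᵢ Fⱼ Fₖ =
  ∣ Fⱼ ─ Fₖ ∣ ≡ 1 × (Fⱼ ─ Fₖ) ⊆ (Fⱼ ─ Fᵢ) × (Fₖ ─ Fⱼ) ⊆ Fᵢ

witness-⊇ : ∀ {A Fᵢ Fⱼ Fₖ : Subset n} → A ⊆ Fᵢ → A ⊆ Fⱼ →
            IsStrongShellingWitness Fᵢ Fⱼ Fₖ → A ⊆ Fₖ
witness-⊇ {Fₖ = Fₖ} A⊆Fᵢ A⊆Fⱼ (_ , Fⱼ─Fₖ⊆Fⱼ─Fᵢ , _) {x} x∈A with x ∈? Fₖ
... | yes x∈Fₖ = x∈Fₖ
... | no  x∉Fₖ = ⊥-elim (x∈p─q⇒x∉q (Fⱼ─Fₖ⊆Fⱼ─Fᵢ (x∈p∧x∉q⇒x∈p─q (A⊆Fⱼ x∈A) x∉Fₖ)) (A⊆Fᵢ x∈A))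

witness-─ : ∀ {A Fᵢ Fⱼ Fₖ : Subset n} → A ⊆ Fᵢ → A ⊆ Fₖ →
            IsStrongShellingWitness Fᵢ Fⱼ Fₖ →
            IsStrongShellingWitness (Fᵢ ─ A) (Fⱼ ─ A) (Fₖ ─ A)
witness-─ {A = A} {Fᵢ} {Fⱼ} {Fₖ} A⊆Fᵢ A⊆Fₖ (size , Fⱼ─Fₖ⊆Fⱼ─Fᵢ , Fₖ─Fⱼ⊆Fᵢ)
  rewrite p─r─[q─r]≡p─q Fⱼ Fₖ A A⊆Fₖ
        | p─r─[q─r]≡p─q Fⱼ Fᵢ A A⊆Fᵢ
        | p─r─[q─r]≡p─q─r Fₖ Fⱼ A
  = size , Fⱼ─Fₖ⊆Fⱼ─Fᵢ , ─-monoˡ-⊆ A Fₖ─Fⱼ⊆Fᵢ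

linkFacets : Subset n → List (Subset n) → List (Subset n)
linkFacets A []      = []
linkFacets A (F ∷ L) with A ⊆? F
... | yes _ = (F ─ A) ∷ linkFacets A L
... | no  _ = linkFacets A L

origin : ∀ (A : Subset n) L → Fin (length (linkFacets A L)) → Fin (length L)
origin A (F ∷ L) p with A ⊆? F
origin A (F ∷ L) zero    | yes _ = zero
origin A (F ∷ L) (suc p) | yes _ = suc (origin A L p)
origin A (F ∷ L) p       | no  _ = suc (origin A L p)

origin-⊇ : ∀ (A : Subset n) L p → A ⊆ lookup L (origin A L p)
origin-⊇ A (F ∷ L) p with A ⊆? F
origin-⊇ A (F ∷ L) zero    | yes A⊆F = A⊆F
origin-⊇ A (F ∷ L) (suc p) | yes _   = origin-⊇ A L p
origin-⊇ A (F ∷ L) p       | no  _   = origin-⊇ A L p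

lookup-linkFacets : ∀ (A : Subset n) L p →
                    lookup (linkFacets A L) p ≡ lookup L (origin A L p) ─ A
lookup-linkFacets A (F ∷ L) p with A ⊆? F
lookup-linkFacets A (F ∷ L) zero    | yes _ = refl
lookup-linkFacets A (F ∷ L) (suc p) | yes _ = lookup-linkFacets A L p
lookup-linkFacets A (F ∷ L) p       | no  _ = lookup-linkFacets A L p

origin-strictMono : ∀ (A : Subset n) L {p q} → p < q → origin A L p < origin A L q
origin-strictMono A (F ∷ L) {p} {q} p<q with A ⊆? F
origin-strictMono A (F ∷ L) {zero}  {suc q} p<q       | yes _ = s≤s z≤n
origin-strictMono A (F ∷ L) {suc p} {suc q} (s≤s p<q) | yes _ = s≤s (origin-strictMono A L p<q)
origin-strictMono A (F ∷ L)                 p<q       | no  _ = s≤s (origin-strictMono A L p<q)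

origin-reflects-< : ∀ (A : Subset n) L {p q} → origin A L p < origin A L q → p < q
origin-reflects-< A L {p} {q} op<oq with <-cmp p q
... | tri< p<q _ _ = p<q
... | tri≈ _ refl _ = ⊥-elim (<-irrefl refl op<oq)
... | tri> _ _ q<p = ⊥-elim (<-asym op<oq (origin-strictMono A L q<p))

origin-surjective : ∀ (A : Subset n) L q → A ⊆ lookup L q →
                    ∃[ p ] origin A L p ≡ q
origin-surjective A (F ∷ L) q A⊆ with A ⊆? F
origin-surjective A (F ∷ L) zero    A⊆F | yes _   = zero , refl
origin-surjective A (F ∷ L) (suc q) A⊆  | yes _   =
  let p , op≡q = origin-surjective A L q A⊆ in suc p , cong suc op≡q
origin-surjective A (F ∷ L) zero    A⊆F | no  A⊈F = ⊥-elim (A⊈F A⊆F)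
origin-surjective A (F ∷ L) (suc q) A⊆  | no  _   =
  let p , op≡q = origin-surjective A L q A⊆ in p , cong suc op≡q

linkFacets-isStrongShellingList : ∀ (A : Subset n) L → IsStrongShellingList L →
                                  IsStrongShellingList (linkFacets A L)
linkFacets-isStrongShellingList A L shelling i j i<j
  with shelling (origin A L i) (origin A L j) (origin-strictMono A L i<j)
... | k , k<j , witness
  with origin-surjective A L k (witness-⊇ (origin-⊇ A L i) (origin-⊇ A L j) witness)
... | p , refl
  rewrite lookup-linkFacets A L i | lookup-linkFacets A L j
  = p , origin-reflects-< A L k<j ,
    subst (IsStrongShellingWitness _ _) (sym (lookup-linkFacets A L p))
          (witness-─ (origin-⊇ A L i) (origin-⊇ A L p) witness)

∈-linkFacets⁻ : ∀ (A : Subset n) L {B} → B ∈ₗ linkFacets A L →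
                ∃[ G ] (G ∈ₗ L × A ⊆ G × B ≡ G ─ A)
∈-linkFacets⁻ A L B∈ =
  lookup L (origin A L p) , ∈-lookup (origin A L p) , origin-⊇ A L p ,
  trans (lookup-index B∈) (lookup-linkFacets A L p)
  where p = index B∈

∈-linkFacets⁺ : ∀ (A : Subset n) L {G} → G ∈ₗ L → A ⊆ G → (G ─ A) ∈ₗ linkFacets A L
∈-linkFacets⁺ A L {G} G∈ A⊆G
  with origin-surjective A L (index G∈) (subst (A ⊆_) (lookup-index G∈) A⊆G)
... | p , op≡q = subst (_∈ₗ linkFacets A L) lookup≡G─A (∈-lookup p)
  where
  open ≡-Reasoning
  lookup≡G─A : lookup (linkFacets A L) p ≡ G ─ A
  lookup≡G─A = begin
    lookup (linkFacets A L) p    ≡⟨ lookup-linkFacets A L p ⟩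
    lookup L (origin A L p) ─ A  ≡⟨ cong (λ q → lookup L q ─ A) op≡q ⟩
    lookup L (index G∈) ─ A      ≡⟨ cong (_─ A) (sym (lookup-index G∈)) ⟩
    G ─ A                        ∎

linkFacets-unique : ∀ (A : Subset n) L → Unique L → Unique (linkFacets A L)
linkFacets-unique A []      []             = []
linkFacets-unique A (F ∷ L) (F∉L ∷ unique) with A ⊆? F
... | yes A⊆F = All.tabulate F─A≢ ∷ linkFacets-unique A L unique
  where
  F─A≢ : ∀ {B} → B ∈ₗ linkFacets A L → ¬ (F ─ A ≡ B)
  F─A≢ B∈ F─A≡B with ∈-linkFacets⁻ A L B∈
  ... | G , G∈L , A⊆G , refl = All.lookup F∉L G∈L (─-cancelʳ A⊆F A⊆G F─A≡B)
... | no  _   = linkFacets-unique A L unique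

─-∈-link : ∀ (Δ : Complex n) {A G} → A ⊆ G → Δ G → link Δ A (G ─ A)
─-∈-link Δ {A} {G} A⊆G ΔG = subst Δ (sym (p─q∪q≡p G A A⊆G)) ΔG , p─q∩q≡⊥ G A

isFacet-link⇒isFacet-∪ : ∀ {Δ : Complex n} {A B} → IsFacet (link Δ A) B → IsFacet Δ (B ∪ A)
isFacet-link⇒isFacet-∪ {Δ = Δ} {A} {B} ((ΔB∪A , B∩A≡⊥) , maximal) =
  ΔB∪A , λ G ΔG → λ (B∪A⊆G , y , y∈G , y∉B∪A) →
    maximal (G ─ A) (─-∈-link Δ (λ x∈A → B∪A⊆G (q⊆p∪q B A x∈A)) ΔG)
      ( (λ x∈B → x∈p∧x∉q⇒x∈p─q (B∪A⊆G (p⊆p∪q A x∈B)) (p∩q≡⊥⇒x∈p⇒x∉q B∩A≡⊥ x∈B))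
      , y , x∈p∧x∉q⇒x∈p─q y∈G (λ y∈A → y∉B∪A (q⊆p∪q B A y∈A))
      , (λ y∈B → y∉B∪A (p⊆p∪q A y∈B)))

isFacet⇒isFacet-link : ∀ {Δ : Complex n} {A G} → A ⊆ G → IsFacet Δ G → IsFacet (link Δ A) (G ─ A)
isFacet⇒isFacet-link {Δ = Δ} {A} {G} A⊆G (ΔG , maximal) =
  ─-∈-link Δ A⊆G ΔG , λ H → λ (ΔH∪A , H∩A≡⊥) (G─A⊆H , y , y∈H , y∉G─A) →
    maximal (H ∪ A) ΔH∪A
      ( G⊆H∪A G─A⊆H , y , p⊆p∪q A y∈H
      , (λ y∈G → y∉G─A (x∈p∧x∉q⇒x∈p─q y∈G (p∩q≡⊥⇒x∈p⇒x∉q H∩A≡⊥ y∈H))))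
  where
  G⊆H∪A : ∀ {H} → G ─ A ⊆ H → G ⊆ H ∪ A
  G⊆H∪A {H} G─A⊆H {x} x∈G with x ∈? A
  ... | yes x∈A = q⊆p∪q H A x∈A
  ... | no  x∉A = p⊆p∪q A (G─A⊆H (x∈p∧x∉q⇒x∈p─q x∈G x∉A))

linkFacets-isFacetOrder : ∀ {Δ : Complex n} (A : Subset n) {L} →
                          IsFacetOrder Δ L → IsFacetOrder (link Δ A) (linkFacets A L)
linkFacets-isFacetOrder A {L} (unique , facets) =
  linkFacets-unique A L unique , λ B → mk⇔ to (from B)
  where
  to : ∀ {B} → B ∈ₗ linkFacets A L → IsFacet _ B
  to B∈ with ∈-linkFacets⁻ A L B∈
  ... | G , G∈L , A⊆G , refl = isFacet⇒isFacet-link A⊆G (Equivalence.to (facets G) G∈L)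
  from : ∀ B → IsFacet _ B → B ∈ₗ linkFacets A L
  from B B-facet@((_ , B∩A≡⊥) , _) =
    subst (_∈ₗ linkFacets A L) (p∪q─q≡p B A B∩A≡⊥)
      (∈-linkFacets⁺ A L (Equivalence.from (facets (B ∪ A)) (isFacet-link⇒isFacet-∪ B-facet))
                         (q⊆p∪q B A))

proposition2p13 : ∀ (n : ℕ) (Δ : Complex n) → IsSimplicialComplex Δ →
    StronglyShellable Δ → ∀ (A : Subset n) → Δ A → StronglyShellable (link Δ A)
proposition2p13 n Δ _ (L , facetOrder , shelling) A _ =
  linkFacets A L ,
  linkFacets-isFacetOrder A facetOrder ,
  linkFacets-isStrongShellingList A L shelling
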